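{- For any $k\in\omega\setminus\{0\}$, $h^a(T_k)\le 3$.
   Context: Let $\omega=\{0,1,2,\ldots\}$, $\mathcal{P}(\omega)$ the set of nonempty finite subsets of $\omega$, $E_2=\{0,1\}$, and $P=\{f_i:i\in\omega\}$ a set of attributes. $\mathcal{M}_2^\infty$ is the set of rectangular tables filled with numbers from $E_2$ with pairwise different rows, each row labeled with a set from $\mathcal{P}(\omega)$ (its set of decisions), and columns labeled with pairwise different attributes from $P$ (the empty table $\Lambda$ included). For $T\in\mathcal{M}_2^\infty$, $\operatorname{At}(T)$ is its set of column attributes, $\Pi(T)$ the intersection of decision sets of its rows; for a word $\alpha=(f_{i_1},\delta_1)\cdots(f_{i_m},\delta_m)$, $T\alpha$ is the subtable of rows having $\delta_j$ in column $f_{i_j}$ for all $j$ ($T\lambda=T$ for the empty word $\lambda$). A $2$-decision tree is a finite directed rooted tree with at least two nodes, where the root and edges leaving it are unlabeled, terminal nodes are labeled with decisions from $\omega$, and every other node is labeled with an attribute from $P$, each edge leaving it labeled with a number from $E_2$. For a complete path $\tau=v_1,d_1,\ldots,v_m,d_m,v_{m+1}$ (root to a terminal node), $\pi(\tau)=\lambda$ if $m=1$, otherwise $\pi(\tau)=(f_{i_2},\delta_2)\cdots(f_{i_m},\delta_m)$ where $v_j$ is labeled $f_{i_j}$ and $d_j$ is labeled $\delta_j$; $T(\tau)=T\pi(\tau)$. For nonempty $T$, a nondeterministic decision tree for $T$ is a $2$-decision tree $\Gamma$ whose attributes lie in $\operatorname{At}(T)$, such that each row of $T$ belongs to $T(\tau)$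 for some complete path $\tau$, and for each complete path $\tau$ either $T(\tau)=\Lambda$ or the decision at its terminal node lies in $\Pi(T(\tau))$. The depth of $\Gamma$ is the maximum length of $\pi(\tau)$ over complete paths $\tau$, and $h^a(T)$ is the minimum depth of a nondeterministic decision tree for $T$. Graph $G_k$: for $k\ge1$ it has $m(k)=k(k+1)/2$ nodes arranged in layers $1,\ldots,k$, layer $i$ containing $i$ nodes $(i,1),\ldots,(i,i)$; node $(i,j)$ has number $(i-1)i/2+j$. For a node $(i,j)$ with $i<k$, its left child is $(i+1,j)$ and its right child is $(i+1,j+1)$; $l(x)$ and $p(x)$ denote the numbers of the left and right child of node number $x$. Define $\nu_k:E_2^{m(k)}\to\mathcal{P}(\omega)$: for $\bar\delta=(\delta_1,\ldots,\delta_{m(k)})$, $\nu_k(\bar\delta)\subseteq\{0,1,\ldots,m(k)\}$, where $0\in\nu_k(\bar\delta)$ iff $\delta_1=0$; for a node number $i$ not in layer $k$, $i\in\nu_k(\bar\delta)$ iff $\delta_i=1$ and $\delta_{l(i)}=\delta_{p(i)}=0$; for $i$ in layer $k$, $i\in\nu_k(\bar\delta)$ iff $\delta_i=1$. $T_k\in\mathcal{M}_2^\infty$ is the table with $m(k)$ columns labeled $f_1,\ldots,f_{m(k)}$ and all $2^{m(k)}$ rows of $E_2^{m(k)}$, each row $\bar\delta$ labeled with $\nu_k(\bar\delta)$. -}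

module Defs where

open import Data.Nat using (ℕ; zero; suc; _+_; _∸_; _≤_; _<_)
open import Data.Bool using (Bool; true; false)
open import Data.Fin using (Fin; toℕ)
open import Data.List using (List; []; _∷_; length)
open import Data.List.NonEmpty using (List⁺; toList)
open import Data.List.Membership.Propositional using (_∈_)
open import Data.Product using (Σ; ∃; ∃-syntax; _×_; _,_)
open import Data.Sum using (_⊎_)
open import Data.Empty using (⊥)
open import Data.Unit using (⊤)
open import Relation.Nullary using (¬_)
open import Relation.Binary.PropositionalEquality using (_≡_)

-- Decision tables (abstractly): a set of rows, a set of column
-- attributes (attribute f_i is represented by its index i), the value
-- of a row in a column, and the set of decisions attached to a row.

record Table : Set₁ where
  field
    Row : Set
    At  : ℕ → Set                 -- i ∈ At  iff  f_i labels a column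
    val : Row → ℕ → Bool → Set    -- val r i b : row r has b in column f_i
    dec : Row → ℕ → Set           -- dec r d : d ∈ decision set of r

open Table public

-- words α = (f_{i_1},δ_1)⋯(f_{i_m},δ_m)
Word : Set
Word = List (ℕ × Bool)

-- row r belongs to the subtable T α
data Sat (T : Table) (r : Row T) : Word → Set where
  []  : Sat T r []
  _∷_ : ∀ {i b α} → val T r i b → Sat T r α → Sat T r ((i , b) ∷ α)

IsEmpty : (T : Table) → Word → Set
IsEmpty T α = ∀ (r : Row T) → ¬ Sat T r α

-- d ∈ Π(T α)  (intersection of decision sets of the rows of T α)
InΠ : (T : Table) → Word → ℕ → Set
InΠ T α d = ∀ (r : Row T) → Sat T r α → dec T r d

-- A non-root node is either terminal (labelled with a decision) or
-- labelled with an attribute f_i and has a nonempty list of leaving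
-- edges, each labelled with a number from E_2 = Bool.
-- The root is unlabelled and has a nonempty list of (unlabelled) edges.

data Node : Set where
  leaf : ℕ → Node
  attr : ℕ → List⁺ (Bool × Node) → Node

record DTree : Set where
  constructor root
  field
    children : List⁺ Node

data NodePath : Node → Word → ℕ → Set where
  stop : ∀ {d} → NodePath (leaf d) [] d
  step : ∀ {i es b c α d} → (b , c) ∈ toList es → NodePath c α d →
         NodePath (attr i es) ((i , b) ∷ α) d

-- CompletePath Γ α d : a complete path τ of Γ with π(τ) = α ending in
-- a terminal node labelled d.
CompletePath : DTree → Word → ℕ → Set
CompletePath (root cs) α d = ∃[ c ] (c ∈ toList cs × NodePath c α d)

data NodeAttrs (P : ℕ → Set) : Node → Set
data EdgeAttrs (P : ℕ → Set) : List (Bool × Node) → Set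

data NodeAttrs P where
  leaf : ∀ {d} → NodeAttrs P (leaf d)
  attr : ∀ {i es} → P i → EdgeAttrs P (toList es) → NodeAttrs P (attr i es)

data EdgeAttrs P where
  []  : EdgeAttrs P []
  _∷_ : ∀ {b c es} → NodeAttrs P c → EdgeAttrs P es → EdgeAttrs P ((b , c) ∷ es)

data RootAttrs (P : ℕ → Set) : List Node → Set where
  []  : RootAttrs P []
  _∷_ : ∀ {c cs} → NodeAttrs P c → RootAttrs P cs → RootAttrs P (c ∷ cs)

TreeAttrs : (ℕ → Set) → DTree → Set
TreeAttrs P (root cs) = RootAttrs P (toList cs)

-- Γ is a nondeterministic decision tree for T (T assumed nonempty)
IsNondetTreeFor : Table → DTree → Set
IsNondetTreeFor T Γ =
  TreeAttrs (At T) Γ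
  × (∀ (r : Row T) → ∃[ α ] ∃[ d ] (CompletePath Γ α d × Sat T r α))
  × (∀ α d → CompletePath Γ α d → IsEmpty T α ⊎ InΠ T α d)

DepthLE : DTree → ℕ → Set
DepthLE Γ n = ∀ α d → CompletePath Γ α d → length α ≤ n

-- h^a(T) ≤ n  (h^a is a minimum, so this means some tree of depth ≤ n exists)
haLE : Table → ℕ → Set
haLE T n = ∃[ Γ ] (IsNondetTreeFor T Γ × DepthLE Γ n)

-- triangular numbers: tri a = a(a+1)/2
tri : ℕ → ℕ
tri zero    = zero
tri (suc a) = suc a + tri a

m : ℕ → ℕ
m k = tri k

-- number of node (i, j) (1 ≤ j ≤ i): (i-1)i/2 + j
num : ℕ → ℕ → ℕ
num i j = tri (i ∸ 1) + j

-- a row is δ̄ ∈ E_2^{m(k)}; coordinate δ_x (x = 1..m(k)) is δ (x-1)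
-- Has δ x b : δ_x = b
Has : ∀ {n} → (Fin n → Bool) → ℕ → Bool → Set
Has δ x b = ∃[ j ] (suc (toℕ j) ≡ x × δ j ≡ b)

data InNu (k : ℕ) (δ : Fin (m k) → Bool) : ℕ → Set where
  zero-in   : Has δ 1 false → InNu k δ 0
  inner-in  : ∀ {i j} → 1 ≤ j → j ≤ i → i < k →
              Has δ (num i j) true →
              Has δ (num (suc i) j) false →          -- left child (i+1, j)
              Has δ (num (suc i) (suc j)) false →    -- right child (i+1, j+1)
              InNu k δ (num i j)
  bottom-in : ∀ {j} → 1 ≤ j → j ≤ k →
              Has δ (num k j) true →
              InNu k δ (num k j)

Tk : ℕ → Table
Tk k = record
  { Row = Fin (m k) → Bool
  ; At  = λ i → 1 ≤ i × i ≤ m k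
  ; val = λ δ i b → Has δ i b
  ; dec = λ δ d → InNu k δ d
  }

{-# OPTIONS --safe #-}
-- A row with δ₁ = 0 has decision 0, witnessed by the single query f₁.  Otherwise
-- follow 1s down G_k from the top node: the walk ends either at a node whose two
-- children carry 0, which is then a decision witnessed by three queries, or in
-- layer k, where one query suffices.  So finitely many decision rules of length
-- at most 3 are true for T_k and cover all its rows, and the root with one
-- branch per rule is a nondeterministic decision tree of depth 3.
module Submission where

open import Defs
open import Data.Nat using (ℕ; zero; suc; _+_; _≤_; _<_; z≤n; s≤s)
open import Data.Nat.Properties
  using (≤-refl; ≤-trans; module ≤-Reasoning; <⇒≤; m≤n⇒m≤1+n; m≤n+m; +-comm; +-suc; +-mono-≤; +-monoʳ-≤)
open import Data.Bool using (Bool; true; false)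
open import Data.Fin using (Fin; fromℕ<)
open import Data.Fin.Properties using (toℕ-fromℕ<)
open import Data.List using (List; []; _∷_; _++_; length; map; concat; applyUpTo)
open import Data.List.NonEmpty as List⁺ using (List⁺; _∷_; toList)
open import Data.List.Relation.Unary.All as All using (All; []; _∷_)
open import Data.List.Relation.Unary.Any using (Any; here; there)
open import Data.List.Membership.Propositional using (_∈_; find; lose)
open import Data.List.Membership.Propositional.Properties
  using (∈-map⁺; ∈-map⁻; ∈-++⁺ˡ; ∈-++⁺ʳ; ∈-++⁻; ∈-concat⁺′; ∈-concat⁻′; ∈-applyUpTo⁺; ∈-applyUpTo⁻)
open import Data.Product using (∃-syntax; _×_; _,_; proj₁; uncurry)
open import Data.Sum using (inj₁; inj₂)
open import Function using (_∘_)
open import Relation.Binary.PropositionalEquality using (_≡_; refl; cong)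

Rule : Set
Rule = Word × ℕ

record IsTrueRule (T : Table) (n : ℕ) (α : Word) (d : ℕ) : Set where
  field
    columns : All (At T ∘ proj₁) α
    sound   : InΠ T α d
    short   : length α ≤ n

chain : Word → ℕ → Node
chain []            d = leaf d
chain ((i , b) ∷ α) d = attr i ((b , chain α d) ∷ [])

chain-path : ∀ α d → NodePath (chain α d) α d
chain-path []            d = stop
chain-path ((i , b) ∷ α) d = step (here refl) (chain-path α d)

chain-path⁻ : ∀ {α d β e} → NodePath (chain α d) β e → β ≡ α × e ≡ d
chain-path⁻ {[]}    stop = refl , refl
chain-path⁻ {_ ∷ α} (step (here refl) p) with chain-path⁻ {α} p
... | refl , refl = refl , refl

chain-attrs : ∀ {P α} d → All (P ∘ proj₁) α → NodeAttrs P (chain α d)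
chain-attrs d []       = leaf
chain-attrs d (p ∷ ps) = attr p (chain-attrs d ps ∷ [])

ruleTree : List⁺ Rule → DTree
ruleTree rs = root (List⁺.map (uncurry chain) rs)

ruleTree-path⁺ : ∀ rs {α d} → (α , d) ∈ toList rs → CompletePath (ruleTree rs) α d
ruleTree-path⁺ (_ ∷ _) {α} {d} r∈ = chain α d , ∈-map⁺ (uncurry chain) r∈ , chain-path α d

ruleTree-path⁻ : ∀ rs {α d} → CompletePath (ruleTree rs) α d → (α , d) ∈ toList rs
ruleTree-path⁻ (_ ∷ _) (_ , c∈ , p) with ∈-map⁻ (uncurry chain) c∈
... | _ , r∈ , refl with chain-path⁻ p
...   | refl , refl = r∈

ruleTree-attrs : ∀ {P} rs → All (All (P ∘ proj₁) ∘ proj₁) rs → RootAttrs P (map (uncurry chain) rs)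
ruleTree-attrs []            []       = []
ruleTree-attrs ((_ , d) ∷ _) (p ∷ ps) = chain-attrs d p ∷ ruleTree-attrs _ ps

trueRules⇒haLE : ∀ T n (rs : List⁺ Rule) →
                 All (uncurry (IsTrueRule T n)) (toList rs) →
                 (∀ r → Any (Sat T r ∘ proj₁) (toList rs)) →
                 haLE T n
trueRules⇒haLE T n rs@(_ ∷ _) valid covers =
  ruleTree rs , (attrs , cover , (λ _ _ → inj₂ ∘ IsTrueRule.sound ∘ ruleOf)) ,
  (λ _ _ → IsTrueRule.short ∘ ruleOf)
  where
  ruleOf : ∀ {α d} → CompletePath (ruleTree rs) α d → IsTrueRule T n α d
  ruleOf τ = All.lookup valid (ruleTree-path⁻ rs τ)

  attrs : TreeAttrs (At T) (ruleTree rs)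
  attrs = ruleTree-attrs (toList rs) (All.map IsTrueRule.columns valid)

  cover : ∀ r → ∃[ α ] ∃[ d ] (CompletePath (ruleTree rs) α d × Sat T r α)
  cover r with find (covers r)
  ... | (α , d) , r∈ , sat = α , d , ruleTree-path⁺ rs r∈ , sat

tri-mono : ∀ {a b} → a ≤ b → tri a ≤ tri b
tri-mono {zero}          _       = z≤n
tri-mono {suc _} {suc _} (s≤s p) = +-mono-≤ (s≤s p) (tri-mono p)

num-column : ∀ {k i j} → 1 ≤ j → j ≤ i → i ≤ k → At (Tk k) (num i j)
num-column {i = zero}  (s≤s _) ()
num-column {k} {suc a} {j} 1≤j j≤i i≤k = ≤-trans 1≤j (m≤n+m j (tri a)) , num≤tri
  where
  open ≤-Reasoning
  num≤tri : tri a + j ≤ tri k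
  num≤tri = begin
    tri a + j     ≤⟨ +-monoʳ-≤ (tri a) j≤i ⟩
    tri a + suc a ≡⟨ +-comm (tri a) (suc a) ⟩
    tri (suc a)   ≤⟨ tri-mono i≤k ⟩
    tri k         ∎

bit-at : ∀ {n} (δ : Fin n → Bool) {x} → 1 ≤ x × x ≤ n → ∃[ b ] Has δ x b
bit-at δ {suc y} (_ , y<n) = δ (fromℕ< y<n) , fromℕ< y<n , cong suc (toℕ-fromℕ< y<n) , refl

innerRule : ℕ → ℕ → Rule
innerRule i j = (num i j , true) ∷ (num (suc i) j , false) ∷ (num (suc i) (suc j) , false) ∷ []
              , num i j

bottomRule : ℕ → ℕ → Rule
bottomRule k j = (num k j , true) ∷ [] , num k j

rootRule : Rule
rootRule = (1 , false) ∷ [] , 0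

data TkRule (k : ℕ) : Rule → Set where
  root-rule   : 1 ≤ k → TkRule k rootRule
  inner-rule  : ∀ {i j} → 1 ≤ j → j ≤ i → i < k → TkRule k (innerRule i j)
  bottom-rule : ∀ {j} → 1 ≤ j → j ≤ k → TkRule k (bottomRule k j)

TkRule-true : ∀ {k r} → TkRule k r → uncurry (IsTrueRule (Tk k) 3) r
TkRule-true (root-rule 1≤k) = record
  { columns = num-column {i = 1} (s≤s z≤n) (s≤s z≤n) 1≤k ∷ []
  ; sound   = λ { _ (h ∷ []) → zero-in h }
  ; short   = s≤s z≤n
  }
TkRule-true (inner-rule 1≤j j≤i i<k) = record
  { columns = num-column 1≤j j≤i (<⇒≤ i<k)
            ∷ num-column 1≤j (m≤n⇒m≤1+n j≤i) i<k
            ∷ num-column (s≤s z≤n) (s≤s j≤i) i<k ∷ []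
  ; sound   = λ { _ (h₁ ∷ h₂ ∷ h₃ ∷ []) → inner-in 1≤j j≤i i<k h₁ h₂ h₃ }
  ; short   = ≤-refl
  }
TkRule-true (bottom-rule 1≤j j≤k) = record
  { columns = num-column 1≤j j≤k ≤-refl ∷ []
  ; sound   = λ { _ (h ∷ []) → bottom-in 1≤j j≤k h }
  ; short   = s≤s z≤n
  }

innerLayer : ℕ → List Rule
innerLayer a = applyUpTo (innerRule (suc a) ∘ suc) (suc a)

innerRules : ℕ → List Rule
innerRules k' = concat (applyUpTo innerLayer k')

bottomRules : ℕ → List Rule
bottomRules k = applyUpTo (bottomRule k ∘ suc) k

TkRules : ℕ → List⁺ Rule
TkRules k' = rootRule ∷ innerRules k' ++ bottomRules (suc k')

TkRules⁺ : ∀ {k' r} → TkRule (suc k') r → r ∈ toList (TkRules k')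
TkRules⁺ (root-rule _) = here refl
TkRules⁺ (inner-rule {suc a} (s≤s z≤n) (s≤s c≤a) (s≤s a<k')) =
  there (∈-++⁺ˡ (∈-concat⁺′ (∈-applyUpTo⁺ (innerRule (suc a) ∘ suc) (s≤s c≤a))
                             (∈-applyUpTo⁺ innerLayer a<k')))
TkRules⁺ {k'} (bottom-rule (s≤s z≤n) j≤k) =
  there (∈-++⁺ʳ (innerRules k') (∈-applyUpTo⁺ (bottomRule (suc k') ∘ suc) j≤k))

TkRules⁻ : ∀ {k' r} → r ∈ toList (TkRules k') → TkRule (suc k') r
TkRules⁻ (here refl) = root-rule (s≤s z≤n)
TkRules⁻ {k'} (there r∈) with ∈-++⁻ (innerRules k') r∈
... | inj₁ r∈inner with ∈-concat⁻′ (applyUpTo innerLayer k') r∈inner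
...   | _ , r∈layer , layer∈ with ∈-applyUpTo⁻ innerLayer layer∈
...     | a , a<k' , refl with ∈-applyUpTo⁻ (innerRule (suc a) ∘ suc) r∈layer
...       | _ , c<a , refl = inner-rule (s≤s z≤n) c<a (s≤s a<k')
TkRules⁻ {k'} (there r∈) | inj₂ r∈bottom with ∈-applyUpTo⁻ (bottomRule (suc k') ∘ suc) r∈bottom
... | _ , c<k , refl = bottom-rule (s≤s z≤n) c<k

Covered : (k : ℕ) → Row (Tk k) → Set
Covered k δ = ∃[ r ] (TkRule k r × Sat (Tk k) δ (proj₁ r))

-- Walk down G_k from a node carrying 1 towards a child carrying 1; the walk
-- stops at a node whose children both carry 0, or in layer k.
descend : ∀ {k} (δ : Row (Tk k)) gap {i j} → gap + i ≡ k →
          1 ≤ j → j ≤ i → Has δ (num i j) true → Covered k δ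
descend δ zero refl 1≤j j≤i h = _ , bottom-rule 1≤j j≤i , h ∷ []
descend δ (suc gap) {i} refl 1≤j j≤i h
  with bit-at δ (num-column 1≤j (m≤n⇒m≤1+n j≤i) (s≤s (m≤n+m i gap)))
     | bit-at δ (num-column (s≤s z≤n) (s≤s j≤i) (s≤s (m≤n+m i gap)))
... | true  , l | _         = descend δ gap (+-suc gap i) 1≤j (m≤n⇒m≤1+n j≤i) l
... | false , _ | true  , r = descend δ gap (+-suc gap i) (s≤s z≤n) (s≤s j≤i) r
... | false , l | false , r = _ , inner-rule 1≤j j≤i (s≤s (m≤n+m i gap)) , h ∷ l ∷ r ∷ []

Tk-covered : ∀ k' (δ : Row (Tk (suc k'))) → Covered (suc k') δ
Tk-covered k' δ with bit-at δ (num-column {suc k'} {1} (s≤s z≤n) (s≤s z≤n) (s≤s z≤n))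
... | false , h = _ , root-rule (s≤s z≤n) , h ∷ []
... | true  , h = descend {suc k'} δ k' (+-comm k' 1) (s≤s z≤n) (s≤s z≤n) h

lemma7 : ∀ (k : ℕ) → 1 ≤ k → haLE (Tk k) 3
lemma7 zero ()
lemma7 (suc k') _ =
  trueRules⇒haLE (Tk (suc k')) 3 (TkRules k')
    (All.tabulate (TkRule-true ∘ TkRules⁻))
    (λ δ → let _ , rule , sat = Tk-covered k' δ in lose (TkRules⁺ rule) sat)
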